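{- Let $q$ be a power of $2$ and $a,b\in\mathbb{N}$. (1) If $\lfloor a/q\rfloor$ is odd, then the monomial $t^{2q^2}[a,b]$ precedes $[a+q,b]$. (2) If $\lfloor b/q\rfloor$ is odd, then the monomial $t^{4q^2}[a,b]$ precedes $[a,b+q]$.
   Context: $\mathbb{N}=\{0,1,2,\dots\}$. Let $g:\mathbb{N}\to\mathbb{N}$ be defined by $g(0)=0$, $g(2n)=4g(n)$, $g(2n+1)=g(2n)+1$. For $a,b\in\mathbb{N}$, $[a,b]$ denotes $t^{1+2g(a)+4g(b)}\in\mathbb{Z}/2[t]$; every $t^k$ with $k$ odd positive is uniquely of this form. Say $[c,d]$ precedes $[a,b]$ if $c+d<a+b$, or $c+d=a+b$ and $d<b$. -}

module Defs where

open import Data.Nat using (ℕ; zero; suc; _+_; _*_; _^_; _<_; _/_; _%_)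
open import Data.Nat.Properties using (m^n≢0)
open import Data.Product using (_×_)
open import Data.Sum using (_⊎_)
open import Relation.Binary.PropositionalEquality using (_≡_)

-- g with fuel: gAux f n computes g n provided f ≥ number of binary digits of n.
-- gAux (suc f) n = 4 * g (n / 2) + (n % 2), matching g(2m)=4g(m), g(2m+1)=4g(m)+1.
gAux : ℕ → ℕ → ℕ
gAux zero    n = 0
gAux (suc f) n = 4 * gAux f (n / 2) + n % 2

-- g(0)=0, g(2n)=4g(n), g(2n+1)=g(2n)+1  (fuel n suffices since n ≥ #bits of n)
g : ℕ → ℕ
g n = gAux n n

-- exponent of the monomial [a,b] = t^(1 + 2g(a) + 4g(b))
bracketExp : ℕ → ℕ → ℕ
bracketExp a b = 1 + 2 * g a + 4 * g b

Precedes : ℕ → ℕ → ℕ → ℕ → Set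
Precedes c d a b = (c + d < a + b) ⊎ ((c + d ≡ a + b) × (d < b))

_/pow2_ : ℕ → ℕ → ℕ
a /pow2 k = _/_ a (2 ^ k) {{m^n≢0 2 k}}

Odd : ℕ → Set
Odd n = n % 2 ≡ 1

-- Write interleave a b = g a + 2 g b: the binary digits of a sit at the even positions and those of b
-- at the odd positions, and [a,b] = t^(1 + 2 interleave a b).  With q = 2^k the hypotheses say that
-- interleave c d is interleave a b plus q², resp. 2q², i.e. plus one at position 2k, resp. 2k + 1.
-- Such an addition leaves the lowest digits alone, so halving a, b, c, d lowers k by one and
-- preserves precedence.  For k = 0 we add 1 (resp. 2), and the oddness of a (resp. b) forces a carry
-- out of its lowest digit.  Adding 1 to an interleaving either sets the lowest digit of an even first
-- coordinate or carries, and by the same halving a carry never makes c + d exceed a + b; this settles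
-- (1) at once and (2) after one more halving.

module Submission where

open import Defs
open import Data.Nat
  using (ℕ; NonZero; zero; suc; _+_; _*_; _^_; _≤_; _<_; _≤′_; ≤′-refl; ≤′-step; _/_; _%_; z≤n; s≤s)
open import Data.Nat.Properties
open import Data.Nat.DivMod
open import Data.Nat.Divisibility using (divides)
open import Data.Nat.Induction using (<-wellFounded)
open import Data.Nat.Tactic.RingSolver using (solve-∀)
open import Data.Product using (_×_; _,_)
open import Data.Sum using (_⊎_; inj₁; inj₂)
open import Induction.WellFounded using (Acc; acc)
open import Relation.Nullary using (yes; no; contradiction)
open import Relation.Binary.PropositionalEquality

private variable a b c d m n f r x y u v w : ℕ

m≡r+[m/2]*2 : m % 2 ≡ r → m ≡ r + m / 2 * 2
m≡r+[m/2]*2 {m} m%2≡r = trans (m≡m%n+[m/n]*n m 2) (cong (_+ m / 2 * 2) m%2≡r)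

%2-/2-injective : m % 2 ≡ n % 2 → m / 2 ≡ n / 2 → m ≡ n
%2-/2-injective {m} {n} p q = begin
  m                 ≡⟨ m≡r+[m/2]*2 p ⟩
  n % 2 + m / 2 * 2 ≡⟨ cong (λ h → n % 2 + h * 2) q ⟩
  n % 2 + n / 2 * 2 ≡⟨ sym (m≡m%n+[m/n]*n n 2) ⟩
  n                 ∎
  where open ≡-Reasoning

%2≡0⊎%2≡1 : ∀ m → m % 2 ≡ 0 ⊎ m % 2 ≡ 1
%2≡0⊎%2≡1 m with m % 2 | m%n<n m 2
... | 0 | _ = inj₁ refl
... | 1 | _ = inj₂ refl
... | suc (suc _) | s≤s (s≤s ())

[m+2*n]%2≡m%2 : ∀ m n → (m + 2 * n) % 2 ≡ m % 2
[m+2*n]%2≡m%2 m n = trans (cong (λ k → (m + k) % 2) (*-comm 2 n)) ([m+kn]%n≡m%n m n 2)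

[m+2*n]/2≡m/2+n : ∀ m n → (m + 2 * n) / 2 ≡ m / 2 + n
[m+2*n]/2≡m/2+n m n = begin
  (m + 2 * n) / 2     ≡⟨ +-distrib-/-∣ʳ m (divides n (*-comm 2 n)) ⟩
  m / 2 + 2 * n / 2   ≡⟨ cong (m / 2 +_) (trans (cong (_/ 2) (*-comm 2 n)) (m*n/n≡m n 2)) ⟩
  m / 2 + n           ∎
  where open ≡-Reasoning

m+n≡[m%2+n%2]+[m/2+n/2]*2 : ∀ m n → m + n ≡ (m % 2 + n % 2) + (m / 2 + n / 2) * 2
m+n≡[m%2+n%2]+[m/2+n/2]*2 m n = trans (cong₂ _+_ (m≡m%n+[m/n]*n m 2) (m≡m%n+[m/n]*n n 2))
  (regroup (m % 2) (n % 2) (m / 2) (n / 2))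
  where
  regroup : ∀ x y p q → (x + p * 2) + (y + q * 2) ≡ (x + y) + (p + q) * 2
  regroup = solve-∀

[u+v*n]%n≡u : ∀ n .{{_ : NonZero n}} → u < n → (u + v * n) % n ≡ u
[u+v*n]%n≡u {u} {v} n u<n = trans ([m+kn]%n≡m%n u v n) (m<n⇒m%n≡m u<n)

[u+v*n]/n≡v : ∀ n .{{_ : NonZero n}} → u < n → (u + v * n) / n ≡ v
[u+v*n]/n≡v {u} {v} n u<n = begin
  (u + v * n) / n    ≡⟨ +-distrib-/-∣ʳ u (divides v refl) ⟩
  u / n + v * n / n  ≡⟨ cong₂ _+_ (m<n⇒m/n≡0 u<n) (m*n/n≡m v n) ⟩
  v                  ∎
  where open ≡-Reasoning

digits-unique : ∀ n .{{_ : NonZero n}} → u < n → x < n → u + v * n ≡ x + w * n → u ≡ x × v ≡ w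
digits-unique {v = v} {w = w} n u<n x<n eq =
  trans (sym ([u+v*n]%n≡u {v = v} n u<n)) (trans (cong (_% n) eq) ([u+v*n]%n≡u {v = w} n x<n)) ,
  trans (sym ([u+v*n]/n≡v n u<n)) (trans (cong (_/ n) eq) ([u+v*n]/n≡v n x<n))

x+y*2<4 : x < 2 → y < 2 → x + y * 2 < 4
x+y*2<4 x<2 y<2 = s≤s (+-mono-≤ (<⇒≤pred x<2) (*-monoˡ-≤ 2 (<⇒≤pred y<2)))

n≤1+f⇒n/2≤f : n ≤ suc f → n / 2 ≤ f
n≤1+f⇒n/2≤f {zero}  _    = z≤n
n≤1+f⇒n/2≤f {suc n} n≤1+f = <⇒≤pred (≤-trans (m/n<m (suc n) 2 (s≤s (s≤s z≤n))) n≤1+f)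

gAux-suc : n ≤ f → gAux (suc f) n ≡ gAux f n
gAux-suc {f = zero}  z≤n   = refl
gAux-suc {n} {suc f} n≤1+f = cong (λ h → 4 * h + n % 2) (gAux-suc (n≤1+f⇒n/2≤f n≤1+f))

gAux-stable : n ≤′ f → gAux f n ≡ g n
gAux-stable ≤′-refl      = refl
gAux-stable (≤′-step p) = trans (gAux-suc (≤′⇒≤ p)) (gAux-stable p)

g-step : ∀ n → g n ≡ n % 2 + g (n / 2) * 4
g-step zero    = refl
g-step (suc n) = begin
  4 * gAux n (suc n / 2) + suc n % 2  ≡⟨ cong (λ h → 4 * h + suc n % 2) (gAux-stable (≤⇒≤′ n/2≤n)) ⟩
  4 * g (suc n / 2) + suc n % 2       ≡⟨ +-comm (4 * g (suc n / 2)) (suc n % 2) ⟩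
  suc n % 2 + 4 * g (suc n / 2)       ≡⟨ cong (suc n % 2 +_) (*-comm 4 (g (suc n / 2))) ⟩
  suc n % 2 + g (suc n / 2) * 4       ∎
  where
  open ≡-Reasoning
  n/2≤n : suc n / 2 ≤ n
  n/2≤n = n≤1+f⇒n/2≤f ≤-refl

n≤g[n] : ∀ n → n ≤ g n
n≤g[n] n = go n (<-wellFounded n)
  where
  go : ∀ n → Acc _<_ n → n ≤ g n
  go zero      _         = z≤n
  go n@(suc _) (acc rec) = begin
    n                      ≡⟨ m≡m%n+[m/n]*n n 2 ⟩
    n % 2 + n / 2 * 2      ≤⟨ +-monoʳ-≤ (n % 2) (*-mono-≤ (go (n / 2) (rec n/2<n)) (s≤s (s≤s z≤n))) ⟩
    n % 2 + g (n / 2) * 4  ≡⟨ sym (g-step n) ⟩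
    g n                    ∎
    where
    open ≤-Reasoning
    n/2<n : n / 2 < n
    n/2<n = m/n<m n 2 (s≤s (s≤s z≤n))

interleave : ℕ → ℕ → ℕ
interleave a b = g a + 2 * g b

interleave-step : ∀ a b → interleave a b ≡ (a % 2 + b % 2 * 2) + interleave (a / 2) (b / 2) * 4
interleave-step a b = begin
  g a + 2 * g b ≡⟨ cong₂ (λ p q → p + 2 * q) (g-step a) (g-step b) ⟩
  (a % 2 + g (a / 2) * 4) + 2 * (b % 2 + g (b / 2) * 4) ≡⟨ regroup (a % 2) (b % 2) (g (a / 2)) (g (b / 2)) ⟩
  (a % 2 + b % 2 * 2) + interleave (a / 2) (b / 2) * 4 ∎
  where
  open ≡-Reasoning
  regroup : ∀ x y p q → (x + p * 4) + 2 * (y + q * 4) ≡ (x + y * 2) + (p + 2 * q) * 4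
  regroup = solve-∀

a+b≤interleave : ∀ a b → a + b ≤ interleave a b
a+b≤interleave a b = +-mono-≤ (n≤g[n] a) (≤-trans (n≤g[n] b) (m≤n*m (g b) 2))

interleave-digits : x < 2 → y < 2 → interleave c d ≡ (x + y * 2) + w * 4 →
                    c % 2 ≡ x × d % 2 ≡ y × interleave (c / 2) (d / 2) ≡ w
interleave-digits {x} {y} {c} {d} x<2 y<2 eq
  with digits-unique 4 (x+y*2<4 (m%n<n c 2) (m%n<n d 2)) (x+y*2<4 x<2 y<2) (trans (sym (interleave-step c d)) eq)
... | low , high with digits-unique 2 (m%n<n c 2) x<2 low
...   | c%2≡x , d%2≡y = c%2≡x , d%2≡y , high

interleave≡0⇒ : interleave a b ≡ 0 → a ≡ 0 × b ≡ 0
interleave≡0⇒ {a} {b} eq = m+n≡0⇒m≡0 a a+b≡0 , m+n≡0⇒n≡0 a a+b≡0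
  where
  a+b≡0 : a + b ≡ 0
  a+b≡0 = n≤0⇒n≡0 (subst (a + b ≤_) eq (a+b≤interleave a b))

interleave-/2-< : ∀ a b → 0 < interleave a b → interleave (a / 2) (b / 2) < interleave a b
interleave-/2-< a b pos = subst (interleave (a / 2) (b / 2) <_) (sym (interleave-step a b))
  (m<u+m*4 (subst (0 <_) (interleave-step a b) pos))
  where
  m<u+m*4 : ∀ {u m} → 0 < u + m * 4 → m < u + m * 4
  m<u+m*4 {m = zero}  pos = pos
  m<u+m*4 {u} {suc m} _   = ≤-trans (m<m*n (suc m) 4 (s≤s (s≤s z≤n))) (m≤n+m (suc m * 4) u)

interleave-injective : ∀ a b c d → interleave c d ≡ interleave a b → c ≡ a × d ≡ b
interleave-injective a b _ _ = go (<-wellFounded (interleave a b))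
  where
  go : ∀ {a b c d} → Acc _<_ (interleave a b) → interleave c d ≡ interleave a b → c ≡ a × d ≡ b
  go {a} {b} {c} {d} (acc rec) eq with interleave a b ≟ 0
  ... | yes ab≡0 with interleave≡0⇒ {a} {b} ab≡0 | interleave≡0⇒ {c} {d} (trans eq ab≡0)
  ...   | a≡0 , b≡0 | c≡0 , d≡0 = trans c≡0 (sym a≡0) , trans d≡0 (sym b≡0)
  go {a} {b} {c} {d} (acc rec) eq | no ab≢0
    with interleave-digits {c = c} {d} (m%n<n a 2) (m%n<n b 2) (trans eq (interleave-step a b))
  ... | c%2≡a%2 , d%2≡b%2 , halves
    with go {a / 2} {b / 2} {c / 2} {d / 2} (rec (interleave-/2-< a b (n≢0⇒n>0 ab≢0))) halves
  ...   | c/2≡a/2 , d/2≡b/2 = %2-/2-injective c%2≡a%2 c/2≡a/2 , %2-/2-injective d%2≡b%2 d/2≡b/2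

interleave-suc : ∀ a b c d → interleave c d ≡ suc (interleave a b) →
                 (a % 2 ≡ 0 × c ≡ suc a × d ≡ b) ⊎ c + d ≤ a + b
interleave-suc a b c d = go (<-wellFounded (interleave a b))
  where
  SucCases : ℕ → ℕ → ℕ → ℕ → Set
  SucCases a b c d = (a % 2 ≡ 0 × c ≡ suc a × d ≡ b) ⊎ c + d ≤ a + b

  +≤1+ : ∀ {a b c d} → SucCases a b c d → c + d ≤ suc (a + b)
  +≤1+ (inj₁ (_ , refl , refl)) = ≤-refl
  +≤1+ (inj₂ c+d≤a+b)           = m≤n⇒m≤1+n c+d≤a+b

  go : ∀ {a b c d} → Acc _<_ (interleave a b) → interleave c d ≡ suc (interleave a b) → SucCases a b c d
  go {a} {b} {c} {d} (acc rec) eq = cases (%2≡0⊎%2≡1 a) (%2≡0⊎%2≡1 b)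
    where
    open ≤-Reasoning
    h : ℕ
    h = interleave (a / 2) (b / 2)

    interleave-ab : ∀ {x y} → a % 2 ≡ x → b % 2 ≡ y → interleave a b ≡ (x + y * 2) + h * 4
    interleave-ab a%2≡x b%2≡y =
      trans (interleave-step a b) (cong₂ (λ x y → (x + y * 2) + h * 4) a%2≡x b%2≡y)

    cases : a % 2 ≡ 0 ⊎ a % 2 ≡ 1 → b % 2 ≡ 0 ⊎ b % 2 ≡ 1 → SucCases a b c d
    cases (inj₁ a%2≡0) _
      with interleave-digits {c = c} {d} (s≤s (s≤s z≤n)) (m%n<n b 2) (trans eq (cong suc (interleave-ab a%2≡0 refl)))
    ... | c%2≡1 , d%2≡b%2 , halves with interleave-injective (a / 2) (b / 2) (c / 2) (d / 2) halves
    ...   | c/2≡a/2 , d/2≡b/2 = inj₁ (a%2≡0 , c≡1+a , %2-/2-injective d%2≡b%2 d/2≡b/2)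
      where
      c≡1+a : c ≡ suc a
      c≡1+a = begin-equality
        c             ≡⟨ m≡r+[m/2]*2 c%2≡1 ⟩
        1 + c / 2 * 2 ≡⟨ cong (λ p → 1 + p * 2) c/2≡a/2 ⟩
        1 + a / 2 * 2 ≡⟨ cong suc (sym (m≡r+[m/2]*2 a%2≡0)) ⟩
        suc a         ∎
    cases (inj₂ a%2≡1) (inj₁ b%2≡0)
      with interleave-digits {c = c} {d} (s≤s z≤n) (s≤s (s≤s z≤n)) (trans eq (cong suc (interleave-ab a%2≡1 b%2≡0)))
    ... | c%2≡0 , d%2≡1 , halves with interleave-injective (a / 2) (b / 2) (c / 2) (d / 2) halves
    ...   | c/2≡a/2 , d/2≡b/2 = inj₂ (begin
      c + d                                 ≡⟨ m+n≡[m%2+n%2]+[m/2+n/2]*2 c d ⟩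
      (c % 2 + d % 2) + (c / 2 + d / 2) * 2 ≡⟨ cong₂ (λ p q → p + q * 2) parities (cong₂ _+_ c/2≡a/2 d/2≡b/2) ⟩
      (a % 2 + b % 2) + (a / 2 + b / 2) * 2 ≡⟨ sym (m+n≡[m%2+n%2]+[m/2+n/2]*2 a b) ⟩
      a + b                                 ∎)
      where
      parities : c % 2 + d % 2 ≡ a % 2 + b % 2
      parities = trans (cong₂ _+_ c%2≡0 d%2≡1) (sym (cong₂ _+_ a%2≡1 b%2≡0))
    cases (inj₂ a%2≡1) (inj₂ b%2≡1)
      with interleave-digits {c = c} {d} {w = suc h} (s≤s z≤n) (s≤s z≤n) (trans eq (cong suc (interleave-ab a%2≡1 b%2≡1)))
    ... | c%2≡0 , d%2≡0 , halves = inj₂ (begin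
      c + d                                 ≡⟨ m+n≡[m%2+n%2]+[m/2+n/2]*2 c d ⟩
      (c % 2 + d % 2) + (c / 2 + d / 2) * 2 ≡⟨ cong (λ p → p + (c / 2 + d / 2) * 2) (cong₂ _+_ c%2≡0 d%2≡0) ⟩
      (c / 2 + d / 2) * 2                   ≤⟨ *-monoˡ-≤ 2 (+≤1+ halves-cases) ⟩
      2 + (a / 2 + b / 2) * 2               ≡⟨ cong (λ p → p + (a / 2 + b / 2) * 2) (sym (cong₂ _+_ a%2≡1 b%2≡1)) ⟩
      (a % 2 + b % 2) + (a / 2 + b / 2) * 2 ≡⟨ sym (m+n≡[m%2+n%2]+[m/2+n/2]*2 a b) ⟩
      a + b                                 ∎)
      where
      halves-cases : SucCases (a / 2) (b / 2) (c / 2) (d / 2)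
      halves-cases = go (rec (interleave-/2-< a b (subst (0 <_) (sym (interleave-ab a%2≡1 b%2≡1)) (s≤s z≤n)))) halves

interleave-suc-odd : ∀ a b c d → Odd a → interleave c d ≡ suc (interleave a b) → c + d ≤ a + b
interleave-suc-odd a b c d a%2≡1 eq with interleave-suc a b c d eq
... | inj₁ (a%2≡0 , _) = contradiction (trans (sym a%2≡0) a%2≡1) λ ()
... | inj₂ c+d≤a+b    = c+d≤a+b

interleave-suc⇒Precedes : ∀ a b c d → interleave c d ≡ suc (interleave a b) → Precedes c d a (suc b)
interleave-suc⇒Precedes a b c d eq with interleave-suc a b c d eq
... | inj₁ (_ , refl , refl) = inj₂ (sym (+-suc a b) , ≤-refl)
... | inj₂ c+d≤a+b           = inj₁ (≤-trans (s≤s c+d≤a+b) (≤-reflexive (sym (+-suc a b))))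

Precedes-from-halves : ∀ {a b c d} → c % 2 ≡ a % 2 → d % 2 ≡ b % 2 →
                       Precedes (c / 2) (d / 2) (a / 2) (b / 2) → Precedes c d a b
Precedes-from-halves {a} {b} {c} {d} c%2≡a%2 d%2≡b%2 = λ
  { (inj₁ lt)        → inj₁ (begin-strict
      c + d                                 ≡⟨ split-c+d ⟩
      (a % 2 + b % 2) + (c / 2 + d / 2) * 2 <⟨ +-monoʳ-< (a % 2 + b % 2) (*-monoˡ-< 2 lt) ⟩
      (a % 2 + b % 2) + (a / 2 + b / 2) * 2 ≡⟨ sym (m+n≡[m%2+n%2]+[m/2+n/2]*2 a b) ⟩
      a + b                                 ∎)
  ; (inj₂ (eq , lt)) → inj₂ ((begin-equality
      c + d                                 ≡⟨ split-c+d ⟩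
      (a % 2 + b % 2) + (c / 2 + d / 2) * 2 ≡⟨ cong (λ s → (a % 2 + b % 2) + s * 2) eq ⟩
      (a % 2 + b % 2) + (a / 2 + b / 2) * 2 ≡⟨ sym (m+n≡[m%2+n%2]+[m/2+n/2]*2 a b) ⟩
      a + b                                 ∎)
    , (begin-strict
      d                 ≡⟨ m≡r+[m/2]*2 d%2≡b%2 ⟩
      b % 2 + d / 2 * 2 <⟨ +-monoʳ-< (b % 2) (*-monoˡ-< 2 lt) ⟩
      b % 2 + b / 2 * 2 ≡⟨ sym (m≡m%n+[m/n]*n b 2) ⟩
      b                 ∎))
  }
  where
  open ≤-Reasoning
  split-c+d : c + d ≡ (a % 2 + b % 2) + (c / 2 + d / 2) * 2
  split-c+d = trans (m+n≡[m%2+n%2]+[m/2+n/2]*2 c d)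
    (cong (λ p → p + (c / 2 + d / 2) * 2) (cong₂ _+_ c%2≡a%2 d%2≡b%2))

interleave-2+-odd⇒Precedes : ∀ a b c d → Odd b → interleave c d ≡ 2 + interleave a b →
                             Precedes c d a (b + 1)
interleave-2+-odd⇒Precedes a b c d b%2≡1 eq
  with interleave-digits {c = c} {d} (m%n<n a 2) (s≤s z≤n) (trans eq (trans (cong (2 +_) ab-digits) (regroup (a % 2) h)))
  where
  h : ℕ
  h = interleave (a / 2) (b / 2)
  ab-digits : interleave a b ≡ (a % 2 + 1 * 2) + h * 4
  ab-digits = trans (interleave-step a b) (cong (λ y → (a % 2 + y * 2) + h * 4) b%2≡1)
  regroup : ∀ x h → 2 + ((x + 1 * 2) + h * 4) ≡ (x + 0 * 2) + (1 + h) * 4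
  regroup = solve-∀
... | c%2≡a%2 , d%2≡0 , halves = subst (Precedes c d a) (sym b+1≡2*[1+b/2])
  (Precedes-from-halves c%2≡a%2 (trans d%2≡0 (sym ([m+2*n]%2≡m%2 0 (suc (b / 2)))))
    (subst (Precedes (c / 2) (d / 2) (a / 2)) (sym ([m+2*n]/2≡m/2+n 0 (suc (b / 2))))
      (interleave-suc⇒Precedes (a / 2) (b / 2) (c / 2) (d / 2) halves)))
  where
  b+1≡2*[1+b/2] : b + 1 ≡ 2 * suc (b / 2)
  b+1≡2*[1+b/2] = trans (cong (_+ 1) (m≡r+[m/2]*2 b%2≡1)) (regroup (b / 2))
    where
    regroup : ∀ h → (1 + h * 2) + 1 ≡ 2 * (1 + h)
    regroup = solve-∀

interleave-shift : ∀ a b c d m → interleave c d ≡ 4 * m + interleave a b →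
                   c % 2 ≡ a % 2 × d % 2 ≡ b % 2 ×
                   interleave (c / 2) (d / 2) ≡ m + interleave (a / 2) (b / 2)
interleave-shift a b c d m eq = interleave-digits {c = c} {d} (m%n<n a 2) (m%n<n b 2)
  (trans eq (trans (cong (4 * m +_) (interleave-step a b))
    (regroup m (a % 2 + b % 2 * 2) (interleave (a / 2) (b / 2)))))
  where
  regroup : ∀ m u h → 4 * m + (u + h * 4) ≡ u + (m + h) * 4
  regroup = solve-∀

Odd-/pow2-zero : ∀ a → Odd (a /pow2 0) → Odd a
Odd-/pow2-zero a = trans (cong (_% 2) (sym (n/1≡n a)))

Odd-/pow2-suc : ∀ k a → Odd (a /pow2 suc k) → Odd ((a / 2) /pow2 k)
Odd-/pow2-suc k a = trans (cong (_% 2) (m/n/o≡m/[n*o] a 2 (2 ^ k) {{_}} {{m^n≢0 2 k}} {{m^n≢0 2 (suc k)}}))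

q²-shift⇒Precedes-a+q : ∀ k a b c d → Odd (a /pow2 k) →
                        interleave c d ≡ 2 ^ k * 2 ^ k + interleave a b → Precedes c d (a + 2 ^ k) b
q²-shift⇒Precedes-a+q zero a b c d odd eq = inj₁ (begin-strict
  c + d     ≤⟨ interleave-suc-odd a b c d (Odd-/pow2-zero a odd) eq ⟩
  a + b     <⟨ +-monoˡ-< b (m<m+n a (s≤s z≤n)) ⟩
  a + 1 + b ∎)
  where open ≤-Reasoning
q²-shift⇒Precedes-a+q (suc k) a b c d odd eq
  with interleave-shift a b c d (2 ^ k * 2 ^ k) (trans eq (cong (_+ interleave a b) (regroup (2 ^ k))))
  where
  regroup : ∀ q → (2 * q) * (2 * q) ≡ 4 * (q * q)
  regroup = solve-∀
... | c%2≡a%2 , d%2≡b%2 , halves = Precedes-from-halves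
  (trans c%2≡a%2 (sym ([m+2*n]%2≡m%2 a (2 ^ k))))
  d%2≡b%2
  (subst (λ x → Precedes (c / 2) (d / 2) x (b / 2)) (sym ([m+2*n]/2≡m/2+n a (2 ^ k)))
    (q²-shift⇒Precedes-a+q k (a / 2) (b / 2) (c / 2) (d / 2) (Odd-/pow2-suc k a odd) halves))

2q²-shift⇒Precedes-b+q : ∀ k a b c d → Odd (b /pow2 k) →
                        interleave c d ≡ 2 * (2 ^ k * 2 ^ k) + interleave a b → Precedes c d a (b + 2 ^ k)
2q²-shift⇒Precedes-b+q zero a b c d odd eq = interleave-2+-odd⇒Precedes a b c d (Odd-/pow2-zero b odd) eq
2q²-shift⇒Precedes-b+q (suc k) a b c d odd eq
  with interleave-shift a b c d (2 * (2 ^ k * 2 ^ k)) (trans eq (cong (_+ interleave a b) (regroup (2 ^ k))))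
  where
  regroup : ∀ q → 2 * ((2 * q) * (2 * q)) ≡ 4 * (2 * (q * q))
  regroup = solve-∀
... | c%2≡a%2 , d%2≡b%2 , halves = Precedes-from-halves {a = a}
  c%2≡a%2
  (trans d%2≡b%2 (sym ([m+2*n]%2≡m%2 b (2 ^ k))))
  (subst (Precedes (c / 2) (d / 2) (a / 2)) (sym ([m+2*n]/2≡m/2+n b (2 ^ k)))
    (2q²-shift⇒Precedes-b+q k (a / 2) (b / 2) (c / 2) (d / 2) (Odd-/pow2-suc k b odd) halves))

bracketExp-shift : ∀ a b c d m → bracketExp c d ≡ 2 * m + bracketExp a b →
                   interleave c d ≡ m + interleave a b
bracketExp-shift a b c d m eq = *-cancelˡ-≡ _ _ 2 (suc-injective (begin
  1 + 2 * interleave c d   ≡⟨ sym (bracketExp≡ c d) ⟩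
  bracketExp c d           ≡⟨ eq ⟩
  2 * m + bracketExp a b   ≡⟨ cong (2 * m +_) (bracketExp≡ a b) ⟩
  2 * m + (1 + 2 * interleave a b) ≡⟨ regroup m (interleave a b) ⟩
  1 + 2 * (m + interleave a b) ∎))
  where
  open ≡-Reasoning
  bracketExp≡ : ∀ a b → bracketExp a b ≡ 1 + 2 * interleave a b
  bracketExp≡ a b = solve (g a) (g b)
    where
    solve : ∀ x y → 1 + 2 * x + 4 * y ≡ 1 + 2 * (x + 2 * y)
    solve = solve-∀
  regroup : ∀ m n → 2 * m + (1 + 2 * n) ≡ 1 + 2 * (m + n)
  regroup = solve-∀

theorem2p7 : (k a b : ℕ) →
    (Odd (a /pow2 k) → (c d : ℕ) →
      bracketExp c d ≡ 2 * (2 ^ k) * (2 ^ k) + bracketExp a b →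
      Precedes c d (a + 2 ^ k) b)
    ×
    (Odd (b /pow2 k) → (c d : ℕ) →
      bracketExp c d ≡ 4 * (2 ^ k) * (2 ^ k) + bracketExp a b →
      Precedes c d a (b + 2 ^ k))
theorem2p7 k a b =
  (λ odd c d eq → q²-shift⇒Precedes-a+q k a b c d odd
    (bracketExp-shift a b c d (q * q) (trans eq (cong (_+ bracketExp a b) (*-assoc 2 q q))))) ,
  (λ odd c d eq → 2q²-shift⇒Precedes-b+q k a b c d odd
    (bracketExp-shift a b c d (2 * (q * q)) (trans eq (cong (_+ bracketExp a b) (regroup q)))))
  where
  q : ℕ
  q = 2 ^ k
  regroup : ∀ p → 4 * p * p ≡ 2 * (2 * (p * p))
  regroup = solve-∀
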